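{- Suppose $(x,z/2)\in\mathbb{R}^2$ has rational Euclidean distance to both $(0,1/2)$ and $(0,-1/2)$. If $x$ is rational with $v_3(x)=0$, then $v_3(z)<0$.
   Context: For a prime $p$ and a nonzero rational $t=p^k r/s$ with $r,s$ integers coprime to $p$, $v_p(t)=k$; and $v_p(0)=\infty$. (Here $z$ is automatically rational.) -}

module Defs where

open import Data.Nat as ℕ using (ℕ)
open import Data.Integer as ℤ using (ℤ; +_; -[1+_])
open import Data.Integer.Divisibility as ℤD using ()
open import Data.Rational as ℚ using (ℚ; _*_)
open import Data.Product using (Σ; _×_)
open import Relation.Nullary using (¬_)
open import Relation.Binary.PropositionalEquality using (_≡_)

fromℤ : ℤ → ℚ
fromℤ n = ℚ._/_ n 1

pos : ℤ → ℕ
pos (+ n)      = n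
pos -[1+ n ]   = 0

neg : ℤ → ℕ
neg (+ n)      = 0
neg -[1+ n ]   = ℕ.suc n

-- HasVal p t k  :  t = p^k * r / s  with r, s integers coprime to p
-- (i.e. v_p(t) = k, t ≠ 0).  Written without division:
--   t * (p^neg(k) * s) = p^pos(k) * r.
-- p ∤ s already forces s ≠ 0, and p ∤ r forces t ≠ 0.
HasVal : ℕ → ℚ → ℤ → Set
HasVal p t k =
  Σ ℤ λ r → Σ ℤ λ s →
    ¬ ((+ p) ℤD.∣ r) × ¬ ((+ p) ℤD.∣ s) ×
    (t * fromℤ ((+ (p ℕ.^ neg k)) ℤ.* s) ≡ fromℤ ((+ (p ℕ.^ pos k)) ℤ.* r))

½ : ℚ
½ = ℚ._/_ (+ 1) 2

-- Write x = a/b, z = n/D and the two distances d = p/q in lowest terms. Clearing denominators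
-- in d² = x² + ((z ∓ 1)/2)² gives 4p²b²D² = q²(4a²D² + (n ∓ D)²b²). If 3 ∤ D, then a, b, D
-- are units mod 3 and squares of units are 1 mod 3, so 3 ∤ n ∓ D would force p² ≡ 2q²,
-- i.e. 3 ∣ p² + q², hence 3 ∣ p and 3 ∣ q, contradicting lowest terms. Thus 3 divides both
-- n - D and n + D, hence D: a contradiction. So 3 ∣ D, and as n is then prime to 3,
-- v₃(z) = -v₃(D) < 0.
module Submission where

open import Defs
open import Data.Nat as ℕ using (ℕ; zero; suc; _^_; s≤s; z≤n)
import Data.Nat.Properties as ℕP
open import Data.Nat.Divisibility as ℕD using (divides)
import Data.Nat.Coprimality as ℕC
open import Data.Nat.Induction using (<-wellFounded)
open import Data.Integer as ℤ using (ℤ; +_; -[1+_])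
import Data.Integer.Properties as ℤP
open import Data.Integer.DivMod using (_%ℕ_; _/ℕ_; a≡a%ℕn+[a/ℕn]*n; n%ℕd<d)
open import Data.Integer.Divisibility.Signed
  using (_∣_; divides; _∣?_; ∣-refl; ∣⇒∣ᵤ; ∣m∣n⇒∣m+n; ∣m∣n⇒∣m-n; ∣m⇒∣-m; ∣m+n∣n⇒∣m; ∣m⇒∣m*n; ∣n⇒∣m*n)
open import Data.Integer.Tactic.RingSolver using (solve-∀)
open import Data.Rational as ℚ using (ℚ; mkℚ; 0ℚ; _+_; _-_; _*_; _≤_; toℚᵘ; fromℚᵘ)
import Data.Rational.Properties as ℚP
open import Data.Rational.Solver using (module +-*-Solver)
open import Data.Rational.Unnormalised as ℚᵘ using (ℚᵘ; mkℚᵘ; *≡*; _≃_)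
import Data.Rational.Unnormalised.Properties as ℚᵘP
open import Data.Product using (Σ; _×_; _,_)
open import Data.Sum using (_⊎_; inj₁; inj₂)
open import Data.Empty using (⊥-elim)
open import Function using (_∘_)
open import Induction.WellFounded using (Acc; acc)
open import Level using (0ℓ)
open import Relation.Nullary using (¬_; yes; no)
open import Relation.Binary.Bundles using (Setoid)
open import Relation.Binary.Structures using (IsEquivalence)
import Relation.Binary.Reasoning.Setoid as SetoidReasoning
open import Relation.Binary.PropositionalEquality

factorise-power : ∀ {p} → 1 ℕ.< p → ∀ n .{{_ : ℕ.NonZero n}} →
  Σ ℕ λ m → Σ ℕ λ s → n ≡ p ^ m ℕ.* s × ¬ p ℕD.∣ s
factorise-power {p} 1<p n = go n (<-wellFounded n)
  where
  go : ∀ n → Acc ℕ._<_ n → .{{_ : ℕ.NonZero n}} → Σ ℕ λ m → Σ ℕ λ s → n ≡ p ^ m ℕ.* s × ¬ p ℕD.∣ s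
  go n (acc rec) with p ℕD.∣? n
  ... | no p∤n = 0 , n , sym (ℕP.+-identityʳ n) , p∤n
  ... | yes (divides q@(suc _) refl) with m , s , q≡pᵐs , p∤s ← go q (rec (ℕP.m<m*n q p 1<p)) =
    suc m , s , trans (ℕP.*-comm q p) (trans (cong (p ℕ.*_) q≡pᵐs) (sym (ℕP.*-assoc p (p ^ m) s))) , p∤s

∣⇒factorise-positive-power : ∀ {p} → 1 ℕ.< p → ∀ n .{{_ : ℕ.NonZero n}} → p ℕD.∣ n →
  Σ ℕ λ m → Σ ℕ λ s → n ≡ p ^ suc m ℕ.* s × ¬ p ℕD.∣ s
∣⇒factorise-positive-power 1<p n p∣n with factorise-power 1<p n
... | zero  , s , n≡s , p∤s = ⊥-elim (p∤s (subst (_ ℕD.∣_) (trans n≡s (ℕP.*-identityˡ s)) p∣n))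
... | suc m , s , n≡pᵐs , p∤s = m , s , n≡pᵐs , p∤s

infix 4 _≈_[mod_]
record _≈_[mod_] (a b m : ℤ) : Set where
  constructor mod-by
  field ∣-difference : m ∣ a ℤ.- b
open _≈_[mod_]

mod-reflexive : ∀ {m a b} → a ≡ b → a ≈ b [mod m ]
mod-reflexive {a = a} refl = mod-by (divides (+ 0) (ℤP.+-inverseʳ a))

mod-sym : ∀ {m a b} → a ≈ b [mod m ] → b ≈ a [mod m ]
mod-sym {a = a} {b} (mod-by m∣a-b) = mod-by (subst (_ ∣_) (negate a b) (∣m⇒∣-m m∣a-b))
  where
  negate : ∀ a b → ℤ.- (a ℤ.- b) ≡ b ℤ.- a
  negate = solve-∀

mod-trans : ∀ {m a b c} → a ≈ b [mod m ] → b ≈ c [mod m ] → a ≈ c [mod m ]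
mod-trans {a = a} {b} {c} (mod-by m∣a-b) (mod-by m∣b-c) =
  mod-by (subst (_ ∣_) (telescope a b c) (∣m∣n⇒∣m+n m∣a-b m∣b-c))
  where
  telescope : ∀ a b c → (a ℤ.- b) ℤ.+ (b ℤ.- c) ≡ a ℤ.- c
  telescope = solve-∀

+-cong-mod : ∀ {m a b c d} → a ≈ b [mod m ] → c ≈ d [mod m ] → a ℤ.+ c ≈ b ℤ.+ d [mod m ]
+-cong-mod {a = a} {b} {c} {d} (mod-by m∣a-b) (mod-by m∣c-d) =
  mod-by (subst (_ ∣_) (regroup a b c d) (∣m∣n⇒∣m+n m∣a-b m∣c-d))
  where
  regroup : ∀ a b c d → (a ℤ.- b) ℤ.+ (c ℤ.- d) ≡ (a ℤ.+ c) ℤ.- (b ℤ.+ d)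
  regroup = solve-∀

*-cong-mod : ∀ {m a b c d} → a ≈ b [mod m ] → c ≈ d [mod m ] → a ℤ.* c ≈ b ℤ.* d [mod m ]
*-cong-mod {a = a} {b} {c} {d} (mod-by m∣a-b) (mod-by m∣c-d) =
  mod-by (subst (_ ∣_) (regroup a b c d) (∣m∣n⇒∣m+n (∣m⇒∣m*n c m∣a-b) (∣n⇒∣m*n b m∣c-d)))
  where
  regroup : ∀ a b c d → (a ℤ.- b) ℤ.* c ℤ.+ b ℤ.* (c ℤ.- d) ≡ a ℤ.* c ℤ.- b ℤ.* d
  regroup = solve-∀

*-congˡ-mod : ∀ {m c d} a → c ≈ d [mod m ] → a ℤ.* c ≈ a ℤ.* d [mod m ]
*-congˡ-mod a = *-cong-mod (mod-reflexive {a = a} refl)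

mod-isEquivalence : ∀ m → IsEquivalence (_≈_[mod m ])
mod-isEquivalence m = record { refl = mod-reflexive refl ; sym = mod-sym ; trans = mod-trans }

mod-setoid : ℤ → Setoid 0ℓ 0ℓ
mod-setoid m = record { isEquivalence = mod-isEquivalence m }

∣⇒≈0 : ∀ {m a} → m ∣ a → a ≈ + 0 [mod m ]
∣⇒≈0 {a = a} m∣a = mod-by (subst (_ ∣_) (sym (ℤP.+-identityʳ a)) m∣a)

1≉0-mod-3 : ¬ (+ 1 ≈ + 0 [mod + 3 ])
1≉0-mod-3 (mod-by 3∣1) with ℕD.∣⇒≤ (∣⇒∣ᵤ 3∣1)
... | s≤s ()

2≉0-mod-3 : ¬ (+ 2 ≈ + 0 [mod + 3 ])
2≉0-mod-3 (mod-by 3∣2) with ℕD.∣⇒≤ (∣⇒∣ᵤ 3∣2)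
... | s≤s (s≤s ())

square-mod-3 : ∀ m → + 3 ∣ m ⊎ m ℤ.* m ≈ + 1 [mod + 3 ]
square-mod-3 m = by-remainder (m %ℕ 3) (m /ℕ 3) (a≡a%ℕn+[a/ℕn]*n m 3) (n%ℕd<d m 3)
  where
  rem≡0 : ∀ q → + 0 ℤ.+ q ℤ.* + 3 ≡ q ℤ.* + 3
  rem≡0 = solve-∀
  rem≡1 : ∀ q → (+ 1 ℤ.+ q ℤ.* + 3) ℤ.* (+ 1 ℤ.+ q ℤ.* + 3) ℤ.- + 1 ≡ (q ℤ.* (+ 2 ℤ.+ q ℤ.* + 3)) ℤ.* + 3
  rem≡1 = solve-∀
  rem≡2 : ∀ q → (+ 2 ℤ.+ q ℤ.* + 3) ℤ.* (+ 2 ℤ.+ q ℤ.* + 3) ℤ.- + 1 ≡ (+ 1 ℤ.+ q ℤ.* (+ 4 ℤ.+ q ℤ.* + 3)) ℤ.* + 3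
  rem≡2 = solve-∀
  by-remainder : ∀ r q → m ≡ + r ℤ.+ q ℤ.* + 3 → r ℕ.< 3 → + 3 ∣ m ⊎ m ℤ.* m ≈ + 1 [mod + 3 ]
  by-remainder 0 q refl _ = inj₁ (divides q (rem≡0 q))
  by-remainder 1 q refl _ = inj₂ (mod-by (divides (q ℤ.* (+ 2 ℤ.+ q ℤ.* + 3)) (rem≡1 q)))
  by-remainder 2 q refl _ = inj₂ (mod-by (divides (+ 1 ℤ.+ q ℤ.* (+ 4 ℤ.+ q ℤ.* + 3)) (rem≡2 q)))
  by-remainder (suc (suc (suc _))) _ _ (s≤s (s≤s (s≤s ())))

3∤⇒square≈1 : ∀ {u} → ¬ (+ 3 ∣ u) → u ℤ.* u ≈ + 1 [mod + 3 ]
3∤⇒square≈1 {u} 3∤u with square-mod-3 u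
... | inj₁ 3∣u  = ⊥-elim (3∤u 3∣u)
... | inj₂ u²≈1 = u²≈1

3∣sum-of-squares⇒3∣ : ∀ p q → + 3 ∣ p ℤ.* p ℤ.+ q ℤ.* q → + 3 ∣ p
3∣sum-of-squares⇒3∣ p q 3∣p²+q² with square-mod-3 p | square-mod-3 q
... | inj₁ 3∣p  | _         = 3∣p
... | inj₂ p²≈1 | inj₁ 3∣q  =
  ⊥-elim (1≉0-mod-3 (mod-trans (mod-sym p²≈1) (∣⇒≈0 (∣m+n∣n⇒∣m 3∣p²+q² (∣m⇒∣m*n q 3∣q)))))
... | inj₂ p²≈1 | inj₂ q²≈1 =
  ⊥-elim (2≉0-mod-3 (mod-trans (mod-sym (+-cong-mod p²≈1 q²≈1)) (∣⇒≈0 3∣p²+q²)))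

3∣m-n⇒3∣m+n⇒3∣n : ∀ {m n} → + 3 ∣ m ℤ.- n → + 3 ∣ m ℤ.+ n → + 3 ∣ n
3∣m-n⇒3∣m+n⇒3∣n {m} {n} 3∣m-n 3∣m+n =
  subst (_ ∣_) (sym (twice-difference m n))
    (∣m∣n⇒∣m-n (∣m⇒∣m*n (+ 2) (∣m∣n⇒∣m-n 3∣m+n 3∣m-n)) (∣n⇒∣m*n n ∣-refl))
  where
  twice-difference : ∀ m n → n ≡ ((m ℤ.+ n) ℤ.- (m ℤ.- n)) ℤ.* + 2 ℤ.- n ℤ.* + 3
  twice-difference = solve-∀

-- (p/q)² = (a/b)² + (N/2D)² with all denominators cleared.
ClearedDistance : (p q a b D N : ℤ) → Set
ClearedDistance p q a b D N =
  + 4 ℤ.* (p ℤ.* p) ℤ.* ((b ℤ.* b) ℤ.* (D ℤ.* D))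
    ≡ (q ℤ.* q) ℤ.* (+ 4 ℤ.* (a ℤ.* a) ℤ.* (D ℤ.* D) ℤ.+ (N ℤ.* N) ℤ.* (b ℤ.* b))

ClearedDistance⇒3∣ : ∀ p q a b D N → ¬ (+ 3 ∣ p × + 3 ∣ q) →
  ¬ (+ 3 ∣ a) → ¬ (+ 3 ∣ b) → ¬ (+ 3 ∣ D) → ClearedDistance p q a b D N → + 3 ∣ N
ClearedDistance⇒3∣ p q a b D N p,q-coprime 3∤a 3∤b 3∤D eq with + 3 ∣? N
... | yes 3∣N = 3∣N
... | no 3∤N =
  ⊥-elim (p,q-coprime (3∣sum-of-squares⇒3∣ p q 3∣p²+q² , 3∣sum-of-squares⇒3∣ q p 3∣q²+p²))
  where
  open SetoidReasoning (mod-setoid (+ 3))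
  4p²≈5q² : + 4 ℤ.* (p ℤ.* p) ℤ.* + 1 ≈ (q ℤ.* q) ℤ.* + 5 [mod + 3 ]
  4p²≈5q² = begin
    + 4 ℤ.* (p ℤ.* p) ℤ.* + 1
      ≈⟨ *-congˡ-mod (+ 4 ℤ.* (p ℤ.* p)) (*-cong-mod (3∤⇒square≈1 3∤b) (3∤⇒square≈1 3∤D)) ⟨
    + 4 ℤ.* (p ℤ.* p) ℤ.* ((b ℤ.* b) ℤ.* (D ℤ.* D))
      ≡⟨ eq ⟩
    (q ℤ.* q) ℤ.* (+ 4 ℤ.* (a ℤ.* a) ℤ.* (D ℤ.* D) ℤ.+ (N ℤ.* N) ℤ.* (b ℤ.* b))
      ≈⟨ *-congˡ-mod (q ℤ.* q) (+-cong-mod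
           (*-cong-mod (*-congˡ-mod (+ 4) (3∤⇒square≈1 3∤a)) (3∤⇒square≈1 3∤D))
           (*-cong-mod (3∤⇒square≈1 3∤N) (3∤⇒square≈1 3∤b))) ⟩
    (q ℤ.* q) ℤ.* + 5 ∎
  rearrange : ∀ p q →
    p ℤ.* p ℤ.+ q ℤ.* q ≡ (+ 4 ℤ.* (p ℤ.* p) ℤ.* + 1 ℤ.- (q ℤ.* q) ℤ.* + 5) ℤ.+ (+ 2 ℤ.* (q ℤ.* q) ℤ.- p ℤ.* p) ℤ.* + 3
  rearrange = solve-∀
  3∣p²+q² : + 3 ∣ p ℤ.* p ℤ.+ q ℤ.* q
  3∣p²+q² = subst (_ ∣_) (sym (rearrange p q))
    (∣m∣n⇒∣m+n (∣-difference 4p²≈5q²) (∣n⇒∣m*n (+ 2 ℤ.* (q ℤ.* q) ℤ.- p ℤ.* p) ∣-refl))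
  3∣q²+p² : + 3 ∣ q ℤ.* q ℤ.+ p ℤ.* p
  3∣q²+p² = subst (_ ∣_) (ℤP.+-comm (p ℤ.* p) (q ℤ.* q)) 3∣p²+q²

toℚᵘ-fromℚᵘ⁻¹ : ∀ p → p ≃ toℚᵘ (fromℚᵘ p)
toℚᵘ-fromℚᵘ⁻¹ p = ℚᵘP.≃-sym (ℚP.toℚᵘ-fromℚᵘ p)

fromℚᵘ-homo-+ : ∀ p q → fromℚᵘ (p ℚᵘ.+ q) ≡ fromℚᵘ p + fromℚᵘ q
fromℚᵘ-homo-+ p q = ℚP.toℚᵘ-injective (begin
  toℚᵘ (fromℚᵘ (p ℚᵘ.+ q))             ≈⟨ ℚP.toℚᵘ-fromℚᵘ _ ⟩
  p ℚᵘ.+ q                               ≈⟨ ℚᵘP.+-cong (toℚᵘ-fromℚᵘ⁻¹ p) (toℚᵘ-fromℚᵘ⁻¹ q) ⟩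
  toℚᵘ (fromℚᵘ p) ℚᵘ.+ toℚᵘ (fromℚᵘ q) ≈⟨ ℚP.toℚᵘ-homo-+ (fromℚᵘ p) (fromℚᵘ q) ⟨
  toℚᵘ (fromℚᵘ p + fromℚᵘ q)           ∎)
  where open ℚᵘP.≃-Reasoning

fromℚᵘ-homo-* : ∀ p q → fromℚᵘ (p ℚᵘ.* q) ≡ fromℚᵘ p * fromℚᵘ q
fromℚᵘ-homo-* p q = ℚP.toℚᵘ-injective (begin
  toℚᵘ (fromℚᵘ (p ℚᵘ.* q))             ≈⟨ ℚP.toℚᵘ-fromℚᵘ _ ⟩
  p ℚᵘ.* q                               ≈⟨ ℚᵘP.*-cong (toℚᵘ-fromℚᵘ⁻¹ p) (toℚᵘ-fromℚᵘ⁻¹ q) ⟩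
  toℚᵘ (fromℚᵘ p) ℚᵘ.* toℚᵘ (fromℚᵘ q) ≈⟨ ℚP.toℚᵘ-homo-* (fromℚᵘ p) (fromℚᵘ q) ⟨
  toℚᵘ (fromℚᵘ p * fromℚᵘ q)           ∎)
  where open ℚᵘP.≃-Reasoning

fromℚᵘ-homo‿- : ∀ p → fromℚᵘ (ℚᵘ.- p) ≡ ℚ.- fromℚᵘ p
fromℚᵘ-homo‿- p = ℚP.toℚᵘ-injective (begin
  toℚᵘ (fromℚᵘ (ℚᵘ.- p))  ≈⟨ ℚP.toℚᵘ-fromℚᵘ _ ⟩
  ℚᵘ.- p                   ≈⟨ ℚᵘP.-‿cong (toℚᵘ-fromℚᵘ⁻¹ p) ⟩
  ℚᵘ.- toℚᵘ (fromℚᵘ p)    ≈⟨ ℚP.toℚᵘ-homo‿- (fromℚᵘ p) ⟨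
  toℚᵘ (ℚ.- fromℚᵘ p)     ∎)
  where open ℚᵘP.≃-Reasoning

-- fromℤ n is definitionally fromℚᵘ (ι n).
ι : ℤ → ℚᵘ
ι n = mkℚᵘ n 0

fromℤ-homo-+ : ∀ a b → fromℤ (a ℤ.+ b) ≡ fromℤ a + fromℤ b
fromℤ-homo-+ a b =
  trans (ℚP.fromℚᵘ-cong {ι (a ℤ.+ b)} {ι a ℚᵘ.+ ι b} (*≡* a+b≡a*1+b*1)) (fromℚᵘ-homo-+ (ι a) (ι b))
  where
  a+b≡a*1+b*1 : (a ℤ.+ b) ℤ.* + 1 ≡ (a ℤ.* + 1 ℤ.+ b ℤ.* + 1) ℤ.* + 1
  a+b≡a*1+b*1 = cong (ℤ._* + 1) (sym (cong₂ ℤ._+_ (ℤP.*-identityʳ a) (ℤP.*-identityʳ b)))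

fromℤ-homo-* : ∀ a b → fromℤ (a ℤ.* b) ≡ fromℤ a * fromℤ b
fromℤ-homo-* a b = fromℚᵘ-homo-* (ι a) (ι b)

fromℤ-homo‿- : ∀ a → fromℤ (ℤ.- a) ≡ ℚ.- fromℤ a
fromℤ-homo‿- a = trans (ℚP.fromℚᵘ-cong {ι (ℤ.- a)} {ℚᵘ.- ι a} (*≡* refl)) (fromℚᵘ-homo‿- (ι a))

fromℤ-homo-- : ∀ a b → fromℤ (a ℤ.- b) ≡ fromℤ a - fromℤ b
fromℤ-homo-- a b = trans (fromℤ-homo-+ a (ℤ.- b)) (cong (λ t → fromℤ a + t) (fromℤ-homo‿- b))

fromℤ-injective : ∀ {a b} → fromℤ a ≡ fromℤ b → a ≡ b
fromℤ-injective {a} {b} eq with ℚP.fromℚᵘ-injective {ι a} {ι b} eq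
... | *≡* a*1≡b*1 = trans (sym (ℤP.*-identityʳ a)) (trans a*1≡b*1 (ℤP.*-identityʳ b))

*-↧≡↥ : ∀ q → q * fromℤ (ℚ.↧ q) ≡ fromℤ (ℚ.↥ q)
*-↧≡↥ q@(mkℚ n d _) = begin
  q * fromℤ (+ suc d)                ≡⟨ cong (_* fromℤ (+ suc d)) (ℚP.fromℚᵘ-toℚᵘ q) ⟨
  fromℚᵘ (toℚᵘ q) * fromℤ (+ suc d)  ≡⟨ fromℚᵘ-homo-* (toℚᵘ q) (ι (+ suc d)) ⟨
  fromℚᵘ (toℚᵘ q ℚᵘ.* ι (+ suc d))   ≡⟨ ℚP.fromℚᵘ-cong {toℚᵘ q ℚᵘ.* ι (+ suc d)} {ι n} (*≡* nd*1≡n*d) ⟩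
  fromℤ n                            ∎
  where
  open ≡-Reasoning
  nd*1≡n*d : (n ℤ.* + suc d) ℤ.* + 1 ≡ n ℤ.* + suc (d ℕ.* 1)
  nd*1≡n*d = trans (ℤP.*-identityʳ _) (cong (λ k → n ℤ.* + suc k) (sym (ℕP.*-identityʳ d)))

pythagoras-cleared : ∀ {d x h P Q A B M D : ℚ} → d * d ≡ x * x + h * h →
  P ≡ d * Q → A ≡ x * B → M ≡ (h + h) * D →
  fromℤ (+ 4) * (P * P) * ((B * B) * (D * D))
    ≡ (Q * Q) * (fromℤ (+ 4) * (A * A) * (D * D) + (M * M) * (B * B))
pythagoras-cleared {d} {x} {h} {Q = Q} {B = B} {D = D} pythagoras refl refl refl = begin
  four * ((d * Q) * (d * Q)) * ((B * B) * (D * D))          ≡⟨ regroup d Q B D ⟩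
  four * (d * d) * (Q * Q * ((B * B) * (D * D)))            ≡⟨ cong (λ t → four * t * _) pythagoras ⟩
  four * (x * x + h * h) * (Q * Q * ((B * B) * (D * D)))    ≡⟨ expand x h Q B D ⟩
  (Q * Q) * (four * ((x * B) * (x * B)) * (D * D) + (((h + h) * D) * ((h + h) * D)) * (B * B)) ∎
  where
  open ≡-Reasoning
  open +-*-Solver using (solve; _:=_; _:+_; _:*_; con)
  four : ℚ
  four = fromℤ (+ 4)
  regroup : ∀ d Q B D →
    four * ((d * Q) * (d * Q)) * ((B * B) * (D * D)) ≡ four * (d * d) * (Q * Q * ((B * B) * (D * D)))
  regroup = solve 4 (λ d Q B D →
    con four :* ((d :* Q) :* (d :* Q)) :* ((B :* B) :* (D :* D))
      := con four :* (d :* d) :* (Q :* Q :* ((B :* B) :* (D :* D)))) refl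
  expand : ∀ x h Q B D → four * (x * x + h * h) * (Q * Q * ((B * B) * (D * D)))
    ≡ (Q * Q) * (four * ((x * B) * (x * B)) * (D * D) + (((h + h) * D) * ((h + h) * D)) * (B * B))
  expand = solve 5 (λ x h Q B D →
    con four :* (x :* x :+ h :* h) :* (Q :* Q :* ((B :* B) :* (D :* D)))
      := (Q :* Q) :* (con four :* ((x :* B) :* (x :* B)) :* (D :* D)
                       :+ (((h :+ h) :* D) :* ((h :+ h) :* D)) :* (B :* B))) refl

pythagoras⇒ClearedDistance : ∀ {d x h : ℚ} a b D N → d * d ≡ x * x + h * h →
  fromℤ a ≡ x * fromℤ b → fromℤ N ≡ (h + h) * fromℤ D → ClearedDistance (ℚ.↥ d) (ℚ.↧ d) a b D N
pythagoras⇒ClearedDistance {d} {x} {h} a b D N pythagoras a≡xb N≡2hD = fromℤ-injective (begin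
  fromℤ (+ 4 ℤ.* (p ℤ.* p) ℤ.* ((b ℤ.* b) ℤ.* (D ℤ.* D)))
    ≡⟨ lhs ⟩
  fromℤ (+ 4) * (fromℤ p * fromℤ p) * ((fromℤ b * fromℤ b) * (fromℤ D * fromℤ D))
    ≡⟨ pythagoras-cleared {d} {x} {h} {fromℤ p} {fromℤ q} {fromℤ a} {fromℤ b} {fromℤ N} {fromℤ D}
         pythagoras (sym (*-↧≡↥ d)) a≡xb N≡2hD ⟩
  (fromℤ q * fromℤ q) * (fromℤ (+ 4) * (fromℤ a * fromℤ a) * (fromℤ D * fromℤ D) + (fromℤ N * fromℤ N) * (fromℤ b * fromℤ b))
    ≡⟨ rhs ⟨
  fromℤ ((q ℤ.* q) ℤ.* (+ 4 ℤ.* (a ℤ.* a) ℤ.* (D ℤ.* D) ℤ.+ (N ℤ.* N) ℤ.* (b ℤ.* b))) ∎)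
  where
  open ≡-Reasoning
  p = ℚ.↥ d
  q = ℚ.↧ d
  lhs : fromℤ (+ 4 ℤ.* (p ℤ.* p) ℤ.* ((b ℤ.* b) ℤ.* (D ℤ.* D)))
    ≡ fromℤ (+ 4) * (fromℤ p * fromℤ p) * ((fromℤ b * fromℤ b) * (fromℤ D * fromℤ D))
  lhs rewrite fromℤ-homo-* (+ 4 ℤ.* (p ℤ.* p)) ((b ℤ.* b) ℤ.* (D ℤ.* D)) | fromℤ-homo-* (+ 4) (p ℤ.* p)
            | fromℤ-homo-* (b ℤ.* b) (D ℤ.* D) | fromℤ-homo-* p p | fromℤ-homo-* b b | fromℤ-homo-* D D = refl
  rhs : fromℤ ((q ℤ.* q) ℤ.* (+ 4 ℤ.* (a ℤ.* a) ℤ.* (D ℤ.* D) ℤ.+ (N ℤ.* N) ℤ.* (b ℤ.* b)))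
    ≡ (fromℤ q * fromℤ q) * (fromℤ (+ 4) * (fromℤ a * fromℤ a) * (fromℤ D * fromℤ D) + (fromℤ N * fromℤ N) * (fromℤ b * fromℤ b))
  rhs rewrite fromℤ-homo-* (q ℤ.* q) (+ 4 ℤ.* (a ℤ.* a) ℤ.* (D ℤ.* D) ℤ.+ (N ℤ.* N) ℤ.* (b ℤ.* b))
            | fromℤ-homo-+ (+ 4 ℤ.* (a ℤ.* a) ℤ.* (D ℤ.* D)) ((N ℤ.* N) ℤ.* (b ℤ.* b))
            | fromℤ-homo-* (+ 4 ℤ.* (a ℤ.* a)) (D ℤ.* D) | fromℤ-homo-* (N ℤ.* N) (b ℤ.* b)
            | fromℤ-homo-* (+ 4) (a ℤ.* a) | fromℤ-homo-* q q | fromℤ-homo-* a a | fromℤ-homo-* b b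
            | fromℤ-homo-* D D | fromℤ-homo-* N N = refl

fromℤ-↥-↧ : ∀ z → fromℤ (ℚ.↥ z ℤ.- ℚ.↧ z) ≡ ((z * ½ - ½) + (z * ½ - ½)) * fromℤ (ℚ.↧ z)
fromℤ-↥-↧ z = begin
  fromℤ (ℚ.↥ z ℤ.- ℚ.↧ z)                ≡⟨ fromℤ-homo-- (ℚ.↥ z) (ℚ.↧ z) ⟩
  fromℤ (ℚ.↥ z) - D                       ≡⟨ cong (_- D) (*-↧≡↥ z) ⟨
  z * D - D                               ≡⟨ double z D ⟨
  ((z * ½ - ½) + (z * ½ - ½)) * D         ∎
  where
  open ≡-Reasoning
  open +-*-Solver using (solve; _:=_; _:+_; _:*_; _:-_; con)
  D : ℚ
  D = fromℤ (ℚ.↧ z)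
  double : ∀ z D → ((z * ½ - ½) + (z * ½ - ½)) * D ≡ z * D - D
  double = solve 2 (λ z D → ((z :* con ½ :- con ½) :+ (z :* con ½ :- con ½)) :* D := z :* D :- D) refl

fromℤ-↥+↧ : ∀ z → fromℤ (ℚ.↥ z ℤ.+ ℚ.↧ z) ≡ ((z * ½ + ½) + (z * ½ + ½)) * fromℤ (ℚ.↧ z)
fromℤ-↥+↧ z = begin
  fromℤ (ℚ.↥ z ℤ.+ ℚ.↧ z)                ≡⟨ fromℤ-homo-+ (ℚ.↥ z) (ℚ.↧ z) ⟩
  fromℤ (ℚ.↥ z) + D                       ≡⟨ cong (_+ D) (*-↧≡↥ z) ⟨
  z * D + D                               ≡⟨ double z D ⟨
  ((z * ½ + ½) + (z * ½ + ½)) * D         ∎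
  where
  open ≡-Reasoning
  open +-*-Solver using (solve; _:=_; _:+_; _:*_; con)
  D : ℚ
  D = fromℤ (ℚ.↧ z)
  double : ∀ z D → ((z * ½ + ½) + (z * ½ + ½)) * D ≡ z * D + D
  double = solve 2 (λ z D → ((z :* con ½ :+ con ½) :+ (z :* con ½ :+ con ½)) :* D := z :* D :+ D) refl

↥-↧-coprime : ∀ {p} → 1 ℕ.< p → ∀ q → p ℕD.∣ ℤ.∣ ℚ.↥ q ∣ → ¬ p ℕD.∣ ℚ.↧ₙ q
↥-↧-coprime 1<p (mkℚ _ _ coprime) p∣n p∣d = ℕP.<⇒≢ 1<p (sym (ℕC.recompute coprime (p∣n , p∣d)))

∣↧⇒negative-valuation : ∀ {p} → 1 ℕ.< p → ∀ q → p ℕD.∣ ℚ.↧ₙ q → Σ ℤ λ k → (k ℤ.< + 0) × HasVal p q k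
∣↧⇒negative-valuation {p} 1<p q@(mkℚ n d _) p∣d with ∣⇒factorise-positive-power 1<p (suc d) p∣d
... | m , s , d≡pᵐs , p∤s =
  -[1+ m ] , ℤ.-<+ , n , + s , (λ p∣n → ↥-↧-coprime 1<p q p∣n p∣d) , p∤s , cleared
  where
  cleared : q * fromℤ (+ (p ^ suc m) ℤ.* + s) ≡ fromℤ (+ 1 ℤ.* n)
  cleared = begin
    q * fromℤ (+ (p ^ suc m) ℤ.* + s)
      ≡⟨ cong (λ t → q * fromℤ t) (trans (cong +_ d≡pᵐs) (ℤP.pos-* (p ^ suc m) s)) ⟨
    q * fromℤ (+ suc d)                 ≡⟨ *-↧≡↥ q ⟩
    fromℤ n                             ≡⟨ cong fromℤ (ℤP.*-identityˡ n) ⟨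
    fromℤ (+ 1 ℤ.* n)                   ∎
    where open ≡-Reasoning

corollary2p4 : (x z d₁ d₂ : ℚ) →
    0ℚ ≤ d₁ → d₁ * d₁ ≡ x * x + (z * ½ - ½) * (z * ½ - ½) →
    0ℚ ≤ d₂ → d₂ * d₂ ≡ x * x + (z * ½ + ½) * (z * ½ + ½) →
    HasVal 3 x (+ 0) →
    Σ ℤ λ k → (k ℤ.< + 0) × HasVal 3 z k
corollary2p4 x z d₁ d₂ _ pythagoras₋ _ pythagoras₊ (a , b , 3∤a , 3∤b , xb≡a) =
  ∣↧⇒negative-valuation 1<3 z (∣⇒∣ᵤ 3∣↧z)
  where
  1<3 : 1 ℕ.< 3
  1<3 = s≤s (s≤s z≤n)
  a≡xb : fromℤ a ≡ x * fromℤ b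
  a≡xb = sym (subst₂ (λ u v → x * fromℤ u ≡ fromℤ v) (ℤP.*-identityˡ b) (ℤP.*-identityˡ a) xb≡a)
  3∣shift : ∀ d h N → d * d ≡ x * x + h * h → fromℤ N ≡ (h + h) * fromℤ (ℚ.↧ z) →
    ¬ (+ 3 ∣ ℚ.↧ z) → + 3 ∣ N
  3∣shift d h N pythagoras N≡2h↧z 3∤↧z = ClearedDistance⇒3∣ (ℚ.↥ d) (ℚ.↧ d) a b (ℚ.↧ z) N
    (λ (3∣↥d , 3∣↧d) → ↥-↧-coprime 1<3 d (∣⇒∣ᵤ 3∣↥d) (∣⇒∣ᵤ 3∣↧d))
    (3∤a ∘ ∣⇒∣ᵤ) (3∤b ∘ ∣⇒∣ᵤ) 3∤↧z
    (pythagoras⇒ClearedDistance {d} {x} {h} a b (ℚ.↧ z) N pythagoras a≡xb N≡2h↧z)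
  3∣↧z : + 3 ∣ ℚ.↧ z
  3∣↧z with + 3 ∣? ℚ.↧ z
  ... | yes 3∣↧z = 3∣↧z
  ... | no 3∤↧z = ⊥-elim (3∤↧z (3∣m-n⇒3∣m+n⇒3∣n {ℚ.↥ z}
          (3∣shift d₁ (z * ½ - ½) (ℚ.↥ z ℤ.- ℚ.↧ z) pythagoras₋ (fromℤ-↥-↧ z) 3∤↧z)
          (3∣shift d₂ (z * ½ + ½) (ℚ.↥ z ℤ.+ ℚ.↧ z) pythagoras₊ (fromℤ-↥+↧ z) 3∤↧z)))
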